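{- Let $\{V_n\}_{n\geq 0}$ be the sequence defined by $V_0=1$, $V_1=8$ and, for $n\geq 1$, $n(n+1)^2 V_{n+1}=8n(3n^2+5n+1)V_n-128(n-1)(n+1)^2V_{n-1}$. Then the sequence $\{\sqrt[n]{V_n}\}_{n\geq 1}$ is strictly log-concave, that is, for all $n\geq 2$, $$\left(\sqrt[n]{V_n}\right)^2>\sqrt[n-1]{V_{n-1}}\cdot\sqrt[n+1]{V_{n+1}}.$$
   Context: $\{V_n\}$ is the Fennessey-Larcombe-French sequence; all its terms are positive. -}

module Defs where

open import Data.Nat as ℕ using (ℕ; zero; suc)
open import Data.Integer as ℤ using (ℤ; +_)
open import Data.Rational using (ℚ; _/_; _+_; _-_; _*_; 1ℚ)

infixr 8 _^ℚ_
_^ℚ_ : ℚ → ℕ → ℚ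
p ^ℚ zero  = 1ℚ
p ^ℚ suc k = p * p ^ℚ k

ℕ→ℚ : ℕ → ℚ
ℕ→ℚ n = (+ n) / 1

-- The Fennessey-Larcombe-French sequence, defined by V 0 = 1, V 1 = 8 and,
-- for n ≥ 1 (written here as n = m + 1),
--   n (n+1)^2 V (n+1) = 8 n (3n^2+5n+1) V n - 128 (n-1) (n+1)^2 V (n-1),
-- solved for V (n+1) by dividing by n (n+1)^2 (nonzero since n ≥ 1).
V : ℕ → ℚ
V zero = 1ℚ
V (suc zero) = ℕ→ℚ 8
V (suc (suc m)) =
  ((ℕ→ℚ (8 ℕ.* n ℕ.* (3 ℕ.* n ℕ.* n ℕ.+ 5 ℕ.* n ℕ.+ 1)) * V (suc m))
    - (ℕ→ℚ (128 ℕ.* m ℕ.* (suc n ℕ.* suc n)) * V m))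
  * ((+ 1) / (suc m ℕ.* (suc n ℕ.* suc n)))
  where
  n : ℕ
  n = suc m

-- The recurrence makes the ratio V(k+2)/V(k+1) = (α k − β k · V k/V(k+1)) / γ k an increasing
-- function of the previous ratio. So, by induction from computed initial values, V(k+1)/V k stays
-- at least 16 + 16/δ k for k ≥ 2 and at most 16 + 32/δ k for k ≥ 4, where δ k = k(k+1)(k+2); each
-- inductive step reduces to a polynomial inequality in k. The lower bound makes the quadratic
-- γ r² − α r + β positive at r = V(k+1)/V k, which is V k · V(k+2) < V(k+1)². The upper bound
-- telescopes to V k ≤ 16^k. For A, B, C = V(n−1), V n, V(n+1), the bounds B ≥ 16 A and
-- A ≤ 16^(n−1) give A^n ≤ B^(n−1), and then
--   A^(n(n+1)) C^((n−1)n) = (A^n)² (AC)^((n−1)n) < (B^(n−1))² (B²)^((n−1)n) = B^(2(n−1)(n+1)).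
-- The polynomial inequalities hold for k ≥ s because, written in j = k − s, the two sides differ
-- by a polynomial with natural coefficients, which normalisation exhibits.

module Submission where

open import Defs
open import Data.Nat using (ℕ; _≤_; _∸_; _+_; _*_)
open import Data.Rational using (ℚ; _<_) renaming (_*_ to _*ℚ_)

open import Algebra.Bundles using (CommutativeMonoid)
open import Data.Integer as ℤ using (+_)
import Data.Integer.Properties as ℤ
open import Data.List using (List; []; _∷_)
open import Data.Nat using (zero; suc)
import Data.Nat as ℕ
import Data.Nat.Properties as ℕ
open import Data.Nat.Coprimality using (1-coprimeTo) renaming (sym to coprime-sym)
open import Data.Nat.Tactic.RingSolver using () renaming (ring to ℕ-ring)
open import Data.Product using (_×_; _,_; proj₁; proj₂)
open import Data.Rational using (0ℚ; 1ℚ; mkℚ)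
import Data.Rational as ℚ
import Data.Rational.Properties as ℚ
open import Function using (_∘_)
open import Level using (0ℓ)
open import Relation.Binary.PropositionalEquality hiding ([_])
open import Relation.Nullary.Decidable using (toWitness; dec⇒maybe)
open import Tactic.RingSolver using (solve; solve-∀)
open import Tactic.RingSolver.Core.AlmostCommutativeRing using (AlmostCommutativeRing; fromCommutativeRing)

open import Algebra.Properties.CommutativeSemigroup
  (CommutativeMonoid.commutativeSemigroup ℚ.*-1-commutativeMonoid) using (interchange)

private
  variable
    p q r : ℚ

ℚ-ring : AlmostCommutativeRing 0ℓ 0ℓ
ℚ-ring = fromCommutativeRing ℚ.+-*-commutativeRing (λ x → dec⇒maybe (0ℚ ℚ.≟ x))

ℕ→ℚ≡mkℚ : ∀ n → ℕ→ℚ n ≡ mkℚ (+ n) 0 (coprime-sym (1-coprimeTo n))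
ℕ→ℚ≡mkℚ n = ℚ.normalize-coprime (coprime-sym (1-coprimeTo n))

ℕ→ℚ-+ : ∀ m n → ℕ→ℚ (m + n) ≡ ℕ→ℚ m ℚ.+ ℕ→ℚ n
ℕ→ℚ-+ m n = trans
  (cong (ℚ._/ 1) (trans (ℤ.pos-+ m n) (sym (cong₂ ℤ._+_ (ℤ.*-identityʳ (+ m)) (ℤ.*-identityʳ (+ n))))))
  (sym (cong₂ ℚ._+_ (ℕ→ℚ≡mkℚ m) (ℕ→ℚ≡mkℚ n)))

ℕ→ℚ-* : ∀ m n → ℕ→ℚ (m * n) ≡ ℕ→ℚ m ℚ.* ℕ→ℚ n
ℕ→ℚ-* m n = trans (cong (ℚ._/ 1) (ℤ.pos-* m n)) (sym (cong₂ ℚ._*_ (ℕ→ℚ≡mkℚ m) (ℕ→ℚ≡mkℚ n)))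

ℕ→ℚ-*³ : ∀ l m n → ℕ→ℚ (l * m * n) ≡ ℕ→ℚ l ℚ.* ℕ→ℚ m ℚ.* ℕ→ℚ n
ℕ→ℚ-*³ l m n = trans (ℕ→ℚ-* (l * m) n) (cong (ℚ._* ℕ→ℚ n) (ℕ→ℚ-* l m))

ℕ→ℚ-mono-≤ : ∀ {m n} → m ≤ n → ℕ→ℚ m ℚ.≤ ℕ→ℚ n
ℕ→ℚ-mono-≤ {m} {n} m≤n rewrite ℕ→ℚ≡mkℚ m | ℕ→ℚ≡mkℚ n =
  ℚ.*≤* (ℤ.*-monoʳ-≤-nonNeg (+ 1) (ℤ.+≤+ m≤n))

ℕ→ℚ-mono-< : ∀ {m n} → m ℕ.< n → ℕ→ℚ m ℚ.< ℕ→ℚ n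
ℕ→ℚ-mono-< {m} {n} m<n rewrite ℕ→ℚ≡mkℚ m | ℕ→ℚ≡mkℚ n =
  ℚ.*<* (ℤ.*-monoʳ-<-pos (+ 1) (ℤ.+<+ m<n))

ℕ→ℚ-nonNeg : ∀ n → 0ℚ ℚ.≤ ℕ→ℚ n
ℕ→ℚ-nonNeg n = ℕ→ℚ-mono-≤ {0} {n} ℕ.z≤n

ℕ→ℚ-pos : ∀ n .{{_ : ℕ.NonZero n}} → 0ℚ ℚ.< ℕ→ℚ n
ℕ→ℚ-pos n = ℕ→ℚ-mono-< {0} {n} (ℕ.>-nonZero⁻¹ n)

ℕ→ℚ-*-reciprocal : ∀ n .{{_ : ℕ.NonZero n}} → ℕ→ℚ n ℚ.* (+ 1 ℚ./ n) ≡ 1ℚ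
ℕ→ℚ-*-reciprocal (suc d) = begin
  ℕ→ℚ (suc d) ℚ.* (+ 1 ℚ./ suc d)
    ≡⟨ cong₂ ℚ._*_ (ℕ→ℚ≡mkℚ (suc d)) (ℚ.normalize-coprime (1-coprimeTo (suc d))) ⟩
  d+1 ℚ.* ℚ.1/ d+1
    ≡⟨ ℚ.*-inverseʳ d+1 ⟩
  1ℚ ∎
  where
  open ≡-Reasoning
  d+1 : ℚ
  d+1 = mkℚ (+ suc d) 0 (coprime-sym (1-coprimeTo (suc d)))

-- The library's monotonicity and cancellation laws for _*_, taking order proofs instead of sign
-- instances; ˡ means that the fixed factor r is on the left.
*-monoˡ-≤ : 0ℚ ℚ.≤ r → p ℚ.≤ q → r ℚ.* p ℚ.≤ r ℚ.* q
*-monoˡ-≤ {r} 0≤r = ℚ.*-monoˡ-≤-nonNeg r {{ℚ.nonNegative 0≤r}}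

*-monoʳ-≤ : 0ℚ ℚ.≤ r → p ℚ.≤ q → p ℚ.* r ℚ.≤ q ℚ.* r
*-monoʳ-≤ {r} 0≤r = ℚ.*-monoʳ-≤-nonNeg r {{ℚ.nonNegative 0≤r}}

*-monoˡ-< : 0ℚ ℚ.< r → p ℚ.< q → r ℚ.* p ℚ.< r ℚ.* q
*-monoˡ-< {r} 0<r = ℚ.*-monoʳ-<-pos r {{ℚ.positive 0<r}}

*-monoʳ-< : 0ℚ ℚ.< r → p ℚ.< q → p ℚ.* r ℚ.< q ℚ.* r
*-monoʳ-< {r} 0<r = ℚ.*-monoˡ-<-pos r {{ℚ.positive 0<r}}

*-cancelˡ-≤ : 0ℚ ℚ.< r → r ℚ.* p ℚ.≤ r ℚ.* q → p ℚ.≤ q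
*-cancelˡ-≤ {r} 0<r = ℚ.*-cancelˡ-≤-pos r {{ℚ.positive 0<r}}

*-cancelˡ-< : 0ℚ ℚ.≤ r → r ℚ.* p ℚ.< r ℚ.* q → p ℚ.< q
*-cancelˡ-< {r} 0≤r = ℚ.*-cancelˡ-<-nonNeg r {{ℚ.nonNegative 0≤r}}

*-nonNeg : 0ℚ ℚ.≤ p → 0ℚ ℚ.≤ q → 0ℚ ℚ.≤ p ℚ.* q
*-nonNeg {p} {q} 0≤p 0≤q = subst (ℚ._≤ p ℚ.* q) (ℚ.*-zeroʳ p) (*-monoˡ-≤ 0≤p 0≤q)

*-pos : 0ℚ ℚ.< p → 0ℚ ℚ.< q → 0ℚ ℚ.< p ℚ.* q
*-pos {p} {q} 0<p 0<q = subst (ℚ._< p ℚ.* q) (ℚ.*-zeroʳ p) (*-monoˡ-< 0<p 0<q)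

0<p*q⇒0<q : 0ℚ ℚ.≤ p → 0ℚ ℚ.< p ℚ.* q → 0ℚ ℚ.< q
0<p*q⇒0<q {p} {q} 0≤p 0<pq = *-cancelˡ-< 0≤p (subst (ℚ._< p ℚ.* q) (sym (ℚ.*-zeroʳ p)) 0<pq)

+-pos-nonNeg : 0ℚ ℚ.< p → 0ℚ ℚ.≤ q → 0ℚ ℚ.< p ℚ.+ q
+-pos-nonNeg = ℚ.+-mono-<-≤

p+q-q≡p : ∀ p q → p ℚ.+ q ℚ.- q ≡ p
p+q-q≡p = solve-∀ ℚ-ring

+-cancelʳ-≤ : p ℚ.+ r ℚ.≤ q ℚ.+ r → p ℚ.≤ q
+-cancelʳ-≤ {p} {r} {q} = subst₂ ℚ._≤_ (p+q-q≡p p r) (p+q-q≡p q r) ∘ ℚ.+-monoˡ-≤ (ℚ.- r)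

p≤q⇒0≤q-p : p ℚ.≤ q → 0ℚ ℚ.≤ q ℚ.- p
p≤q⇒0≤q-p {p} {q} p≤q = subst (ℚ._≤ q ℚ.- p) (ℚ.+-inverseʳ p) (ℚ.+-monoˡ-≤ (ℚ.- p) p≤q)

p<q⇒0<q-p : p ℚ.< q → 0ℚ ℚ.< q ℚ.- p
p<q⇒0<q-p {p} {q} p<q = subst (ℚ._< q ℚ.- p) (ℚ.+-inverseʳ p) (ℚ.+-monoˡ-< (ℚ.- p) p<q)

^ℚ-+ : ∀ p m n → p ^ℚ (m + n) ≡ p ^ℚ m ℚ.* p ^ℚ n
^ℚ-+ p zero    n = sym (ℚ.*-identityˡ _)
^ℚ-+ p (suc m) n = trans (cong (p ℚ.*_) (^ℚ-+ p m n)) (sym (ℚ.*-assoc p _ _))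

^ℚ-distribʳ-* : ∀ p q n → (p ℚ.* q) ^ℚ n ≡ p ^ℚ n ℚ.* q ^ℚ n
^ℚ-distribʳ-* p q zero    = refl
^ℚ-distribʳ-* p q (suc n) = trans (cong ((p ℚ.* q) ℚ.*_) (^ℚ-distribʳ-* p q n)) (interchange p q _ _)

^ℚ-nonNeg : ∀ n → 0ℚ ℚ.≤ p → 0ℚ ℚ.≤ p ^ℚ n
^ℚ-nonNeg zero    _   = toWitness {a? = 0ℚ ℚ.≤? 1ℚ} _
^ℚ-nonNeg (suc n) 0≤p = *-nonNeg 0≤p (^ℚ-nonNeg n 0≤p)

^ℚ-pos : ∀ n → 0ℚ ℚ.< p → 0ℚ ℚ.< p ^ℚ n
^ℚ-pos zero    _   = toWitness {a? = 0ℚ ℚ.<? 1ℚ} _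
^ℚ-pos (suc n) 0<p = *-pos 0<p (^ℚ-pos n 0<p)

^ℚ-monoˡ-≤ : ∀ n → 0ℚ ℚ.≤ p → p ℚ.≤ q → p ^ℚ n ℚ.≤ q ^ℚ n
^ℚ-monoˡ-≤ zero    _   _   = ℚ.≤-refl
^ℚ-monoˡ-≤ (suc n) 0≤p p≤q = ℚ.≤-trans (*-monoʳ-≤ (^ℚ-nonNeg n 0≤p) p≤q)
  (*-monoˡ-≤ (ℚ.≤-trans 0≤p p≤q) (^ℚ-monoˡ-≤ n 0≤p p≤q))

^ℚ-monoˡ-< : ∀ n .{{_ : ℕ.NonZero n}} → 0ℚ ℚ.≤ p → p ℚ.< q → p ^ℚ n ℚ.< q ^ℚ n
^ℚ-monoˡ-< (suc n) 0≤p p<q = ℚ.≤-<-trans (*-monoˡ-≤ 0≤p (^ℚ-monoˡ-≤ n 0≤p (ℚ.<⇒≤ p<q)))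
  (*-monoʳ-< (^ℚ-pos n (ℚ.≤-<-trans 0≤p p<q)) p<q)

^ℚ-split : ∀ p q k l → p ^ℚ (k + k + l) ℚ.* q ^ℚ l ≡ p ^ℚ k ℚ.* p ^ℚ k ℚ.* (p ℚ.* q) ^ℚ l
^ℚ-split p q k l = begin
  p ^ℚ (k + k + l) ℚ.* q ^ℚ l               ≡⟨ cong (ℚ._* q ^ℚ l) (^ℚ-+ p (k + k) l) ⟩
  p ^ℚ (k + k) ℚ.* p ^ℚ l ℚ.* q ^ℚ l        ≡⟨ cong (λ t → t ℚ.* p ^ℚ l ℚ.* q ^ℚ l) (^ℚ-+ p k k) ⟩
  p ^ℚ k ℚ.* p ^ℚ k ℚ.* p ^ℚ l ℚ.* q ^ℚ l   ≡⟨ ℚ.*-assoc (p ^ℚ k ℚ.* p ^ℚ k) (p ^ℚ l) (q ^ℚ l) ⟩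
  p ^ℚ k ℚ.* p ^ℚ k ℚ.* (p ^ℚ l ℚ.* q ^ℚ l) ≡⟨ cong (p ^ℚ k ℚ.* p ^ℚ k ℚ.*_) (^ℚ-distribʳ-* p q l) ⟨
  p ^ℚ k ℚ.* p ^ℚ k ℚ.* (p ℚ.* q) ^ℚ l      ∎
  where open ≡-Reasoning

^ℚ-suc≤^ℚ : ∀ n {p q t : ℚ} → 0ℚ ℚ.≤ p → 0ℚ ℚ.≤ t → t ℚ.* p ℚ.≤ q → p ℚ.≤ t ^ℚ n →
            p ^ℚ suc n ℚ.≤ q ^ℚ n
^ℚ-suc≤^ℚ n {p} {q} {t} 0≤p 0≤t tp≤q p≤tⁿ = begin
  p ℚ.* p ^ℚ n      ≤⟨ *-monoʳ-≤ (^ℚ-nonNeg n 0≤p) p≤tⁿ ⟩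
  t ^ℚ n ℚ.* p ^ℚ n ≡⟨ ^ℚ-distribʳ-* t p n ⟨
  (t ℚ.* p) ^ℚ n    ≤⟨ ^ℚ-monoˡ-≤ n (*-nonNeg 0≤t 0≤p) tp≤q ⟩
  q ^ℚ n            ∎
  where open ℚ.≤-Reasoning

log-concave⇒root-log-concave : ∀ m {A B C : ℚ} → let n = 2 + m in
  0ℚ ℚ.< A → 0ℚ ℚ.≤ B → 0ℚ ℚ.≤ C → A ℚ.* C ℚ.< B ℚ.* B → A ^ℚ n ℚ.≤ B ^ℚ (n ∸ 1) →
  A ^ℚ (n * (n + 1)) ℚ.* C ^ℚ ((n ∸ 1) * n) ℚ.< B ^ℚ (2 * (n ∸ 1) * (n + 1))
log-concave⇒root-log-concave m {A} {B} {C} 0<A 0≤B 0≤C AC<BB Aⁿ≤Bⁿ⁻¹ = begin-strict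
  A ^ℚ (n * (n + 1)) ℚ.* C ^ℚ e          ≡⟨ cong (λ k → A ^ℚ k ℚ.* C ^ℚ e) (lhs-exponent m) ⟩
  A ^ℚ (n + n + e) ℚ.* C ^ℚ e            ≡⟨ ^ℚ-split A C n e ⟩
  Aⁿ ℚ.* Aⁿ ℚ.* (A ℚ.* C) ^ℚ e            <⟨ *-monoˡ-< (*-pos (^ℚ-pos n 0<A) (^ℚ-pos n 0<A))
                                                        (^ℚ-monoˡ-< e (*-nonNeg 0≤A 0≤C) AC<BB) ⟩
  Aⁿ ℚ.* Aⁿ ℚ.* (B ℚ.* B) ^ℚ e            ≤⟨ *-monoʳ-≤ (^ℚ-nonNeg e (*-nonNeg 0≤B 0≤B)) Aⁿ²≤Bⁿ⁻¹² ⟩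
  Bⁿ⁻¹ ℚ.* Bⁿ⁻¹ ℚ.* (B ℚ.* B) ^ℚ e        ≡⟨ ^ℚ-split B B (n ∸ 1) e ⟨
  B ^ℚ (n ∸ 1 + (n ∸ 1) + e) ℚ.* B ^ℚ e  ≡⟨ ^ℚ-+ B (n ∸ 1 + (n ∸ 1) + e) e ⟨
  B ^ℚ (n ∸ 1 + (n ∸ 1) + e + e)         ≡⟨ cong (B ^ℚ_) (rhs-exponent m) ⟨
  B ^ℚ (2 * (n ∸ 1) * (n + 1))           ∎
  where
  open ℚ.≤-Reasoning
  n e : ℕ
  n = 2 + m
  e = (n ∸ 1) * n
  Aⁿ Bⁿ⁻¹ : ℚ
  Aⁿ = A ^ℚ n
  Bⁿ⁻¹ = B ^ℚ (n ∸ 1)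
  0≤A : 0ℚ ℚ.≤ A
  0≤A = ℚ.<⇒≤ 0<A
  Aⁿ²≤Bⁿ⁻¹² : Aⁿ ℚ.* Aⁿ ℚ.≤ Bⁿ⁻¹ ℚ.* Bⁿ⁻¹
  Aⁿ²≤Bⁿ⁻¹² = ℚ.≤-trans (*-monoʳ-≤ (^ℚ-nonNeg n 0≤A) Aⁿ≤Bⁿ⁻¹)
                        (*-monoˡ-≤ (^ℚ-nonNeg (n ∸ 1) 0≤B) Aⁿ≤Bⁿ⁻¹)
  lhs-exponent : ∀ m → (2 + m) * (2 + m + 1) ≡ 2 + m + (2 + m) + (1 + m) * (2 + m)
  lhs-exponent = solve-∀ ℕ-ring
  rhs-exponent : ∀ m → 2 * (1 + m) * (2 + m + 1) ≡ 1 + m + (1 + m) + (1 + m) * (2 + m) + (1 + m) * (2 + m)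
  rhs-exponent = solve-∀ ℕ-ring

-- Three-term recurrences c z + b x = a y, with ratio bounds y/x ≥ p/q written p x ≤ q y

ratio-lower-step : ∀ a b c p q p′ q′ {x y z : ℚ} → 0ℚ ℚ.≤ y → 0ℚ ℚ.≤ q′ ℚ.* b → 0ℚ ℚ.< p ℚ.* c →
  c ℚ.* z ℚ.+ b ℚ.* x ≡ a ℚ.* y → p ℚ.* x ℚ.≤ q ℚ.* y →
  q′ ℚ.* b ℚ.* q ℚ.+ p ℚ.* c ℚ.* p′ ℚ.≤ q′ ℚ.* a ℚ.* p →
  p′ ℚ.* y ℚ.≤ q′ ℚ.* z
ratio-lower-step a b c p q p′ q′ {x} {y} {z} 0≤y 0≤q′b 0<pc rec px≤qy poly =
  *-cancelˡ-≤ 0<pc (+-cancelʳ-≤ (begin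
    p ℚ.* c ℚ.* (p′ ℚ.* y) ℚ.+ q′ ℚ.* b ℚ.* (q ℚ.* y)
      ≡⟨ solve (p ∷ c ∷ p′ ∷ y ∷ q′ ∷ b ∷ q ∷ []) ℚ-ring ⟩
    (q′ ℚ.* b ℚ.* q ℚ.+ p ℚ.* c ℚ.* p′) ℚ.* y
      ≤⟨ *-monoʳ-≤ 0≤y poly ⟩
    q′ ℚ.* a ℚ.* p ℚ.* y
      ≡⟨ solve (q′ ∷ a ∷ p ∷ y ∷ []) ℚ-ring ⟩
    q′ ℚ.* p ℚ.* (a ℚ.* y)
      ≡⟨ cong (q′ ℚ.* p ℚ.*_) rec ⟨
    q′ ℚ.* p ℚ.* (c ℚ.* z ℚ.+ b ℚ.* x)
      ≡⟨ solve (q′ ∷ p ∷ c ∷ z ∷ b ∷ x ∷ []) ℚ-ring ⟩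
    p ℚ.* c ℚ.* (q′ ℚ.* z) ℚ.+ q′ ℚ.* b ℚ.* (p ℚ.* x)
      ≤⟨ ℚ.+-monoʳ-≤ (p ℚ.* c ℚ.* (q′ ℚ.* z)) (*-monoˡ-≤ 0≤q′b px≤qy) ⟩
    p ℚ.* c ℚ.* (q′ ℚ.* z) ℚ.+ q′ ℚ.* b ℚ.* (q ℚ.* y) ∎))
  where open ℚ.≤-Reasoning

ratio-upper-step : ∀ a b c p q p′ q′ {x y z : ℚ} → 0ℚ ℚ.≤ y → 0ℚ ℚ.≤ q′ ℚ.* b → 0ℚ ℚ.< p ℚ.* c →
  c ℚ.* z ℚ.+ b ℚ.* x ≡ a ℚ.* y → q ℚ.* y ℚ.≤ p ℚ.* x →
  q′ ℚ.* p ℚ.* a ℚ.≤ q′ ℚ.* b ℚ.* q ℚ.+ p ℚ.* c ℚ.* p′ →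
  q′ ℚ.* z ℚ.≤ p′ ℚ.* y
ratio-upper-step a b c p q p′ q′ {x} {y} {z} 0≤y 0≤q′b 0<pc rec qy≤px poly =
  *-cancelˡ-≤ 0<pc (+-cancelʳ-≤ (begin
    p ℚ.* c ℚ.* (q′ ℚ.* z) ℚ.+ q′ ℚ.* b ℚ.* (q ℚ.* y)
      ≤⟨ ℚ.+-monoʳ-≤ (p ℚ.* c ℚ.* (q′ ℚ.* z)) (*-monoˡ-≤ 0≤q′b qy≤px) ⟩
    p ℚ.* c ℚ.* (q′ ℚ.* z) ℚ.+ q′ ℚ.* b ℚ.* (p ℚ.* x)
      ≡⟨ solve (q′ ∷ p ∷ c ∷ z ∷ b ∷ x ∷ []) ℚ-ring ⟩
    q′ ℚ.* p ℚ.* (c ℚ.* z ℚ.+ b ℚ.* x)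
      ≡⟨ cong (q′ ℚ.* p ℚ.*_) rec ⟩
    q′ ℚ.* p ℚ.* (a ℚ.* y)
      ≡⟨ solve (q′ ∷ p ∷ a ∷ y ∷ []) ℚ-ring ⟩
    q′ ℚ.* p ℚ.* a ℚ.* y
      ≤⟨ *-monoʳ-≤ 0≤y poly ⟩
    (q′ ℚ.* b ℚ.* q ℚ.+ p ℚ.* c ℚ.* p′) ℚ.* y
      ≡⟨ solve (p ∷ c ∷ p′ ∷ y ∷ q′ ∷ b ∷ q ∷ []) ℚ-ring ⟩
    p ℚ.* c ℚ.* (p′ ℚ.* y) ℚ.+ q′ ℚ.* b ℚ.* (q ℚ.* y) ∎))
  where open ℚ.≤-Reasoning

-- With s = q y − p x ≥ 0, the gap c q² (y² − x z) equals E₂ x² + E₁ x s + c s², where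
-- E₁ = 2 c p − a q ≥ 0 and E₂ = c p² + b q² − a q p > 0 are the two polynomial hypotheses.
ratio-lower⇒log-concave : ∀ a b c p q {x y z : ℚ} → 0ℚ ℚ.< x → 0ℚ ℚ.≤ c → 0ℚ ℚ.≤ c ℚ.* q ℚ.* q →
  c ℚ.* z ℚ.+ b ℚ.* x ≡ a ℚ.* y → p ℚ.* x ℚ.≤ q ℚ.* y →
  a ℚ.* q ℚ.≤ c ℚ.* p ℚ.+ c ℚ.* p →
  a ℚ.* q ℚ.* p ℚ.< c ℚ.* p ℚ.* p ℚ.+ b ℚ.* q ℚ.* q →
  x ℚ.* z ℚ.< y ℚ.* y
ratio-lower⇒log-concave a b c p q {x} {y} {z} 0<x 0≤c 0≤cqq rec px≤qy E₁-nonNeg E₂-pos =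
  *-cancelˡ-< 0≤cqq (begin-strict
    c ℚ.* q ℚ.* q ℚ.* (x ℚ.* z)  ≡⟨ solve (c ∷ q ∷ x ∷ z ∷ []) ℚ-ring ⟩
    q ℚ.* q ℚ.* x ℚ.* (c ℚ.* z)  ≡⟨ cong (q ℚ.* q ℚ.* x ℚ.*_) cz≡ay-bx ⟩
    qqx[ay-bx]                   ≡⟨ ℚ.+-identityʳ qqx[ay-bx] ⟨
    qqx[ay-bx] ℚ.+ 0ℚ            <⟨ ℚ.+-monoʳ-< qqx[ay-bx] 0<gap ⟩
    qqx[ay-bx] ℚ.+ gap           ≡⟨ expand a b c p q x y ⟩
    c ℚ.* q ℚ.* q ℚ.* (y ℚ.* y)  ∎)
  where
  open ℚ.≤-Reasoning
  cz≡ay-bx : c ℚ.* z ≡ a ℚ.* y ℚ.- b ℚ.* x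
  cz≡ay-bx = trans (sym (p+q-q≡p (c ℚ.* z) (b ℚ.* x))) (cong (ℚ._- b ℚ.* x) rec)
  s qqx[ay-bx] gap : ℚ
  s = q ℚ.* y ℚ.- p ℚ.* x
  qqx[ay-bx] = q ℚ.* q ℚ.* x ℚ.* (a ℚ.* y ℚ.- b ℚ.* x)
  gap = (c ℚ.* p ℚ.* p ℚ.+ b ℚ.* q ℚ.* q ℚ.- a ℚ.* q ℚ.* p) ℚ.* (x ℚ.* x)
      ℚ.+ (c ℚ.* p ℚ.+ c ℚ.* p ℚ.- a ℚ.* q) ℚ.* (x ℚ.* s) ℚ.+ c ℚ.* (s ℚ.* s)
  0≤s : 0ℚ ℚ.≤ s
  0≤s = p≤q⇒0≤q-p px≤qy
  0<gap : 0ℚ ℚ.< gap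
  0<gap = +-pos-nonNeg
    (+-pos-nonNeg (*-pos (p<q⇒0<q-p E₂-pos) (*-pos 0<x 0<x))
                  (*-nonNeg (p≤q⇒0≤q-p E₁-nonNeg) (*-nonNeg (ℚ.<⇒≤ 0<x) 0≤s)))
    (*-nonNeg 0≤c (*-nonNeg 0≤s 0≤s))
  expand : ∀ a b c p q x y →
    q ℚ.* q ℚ.* x ℚ.* (a ℚ.* y ℚ.- b ℚ.* x)
      ℚ.+ ((c ℚ.* p ℚ.* p ℚ.+ b ℚ.* q ℚ.* q ℚ.- a ℚ.* q ℚ.* p) ℚ.* (x ℚ.* x)
      ℚ.+ (c ℚ.* p ℚ.+ c ℚ.* p ℚ.- a ℚ.* q) ℚ.* (x ℚ.* (q ℚ.* y ℚ.- p ℚ.* x))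
      ℚ.+ c ℚ.* ((q ℚ.* y ℚ.- p ℚ.* x) ℚ.* (q ℚ.* y ℚ.- p ℚ.* x)))
    ≡ c ℚ.* q ℚ.* q ℚ.* (y ℚ.* y)
  expand = solve-∀ ℚ-ring

-- From x ≤ t (1 − 1/r) and y/x ≤ p/q, with denominators cleared, to y ≤ s t (1 − 1/r′).
power-bound-step : ∀ p q r r′ s t {x y : ℚ} →
  0ℚ ℚ.≤ t → 0ℚ ℚ.≤ r′ ℚ.* r → 0ℚ ℚ.≤ r′ ℚ.* p → 0ℚ ℚ.< q ℚ.* r →
  q ℚ.* y ℚ.≤ p ℚ.* x → r ℚ.* x ℚ.+ t ℚ.≤ t ℚ.* r →
  r′ ℚ.* p ℚ.* r ℚ.+ s ℚ.* q ℚ.* r ℚ.≤ s ℚ.* q ℚ.* r ℚ.* r′ ℚ.+ r′ ℚ.* p →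
  r′ ℚ.* y ℚ.+ s ℚ.* t ℚ.≤ s ℚ.* t ℚ.* r′
power-bound-step p q r r′ s t {x} {y} 0≤t 0≤r′r 0≤r′p 0<qr qy≤px x-bound poly =
  *-cancelˡ-≤ 0<qr (+-cancelʳ-≤ (begin
    q ℚ.* r ℚ.* (r′ ℚ.* y ℚ.+ s ℚ.* t) ℚ.+ r′ ℚ.* p ℚ.* t
      ≡⟨ solve (q ∷ r ∷ r′ ∷ y ∷ s ∷ t ∷ p ∷ []) ℚ-ring ⟩
    r′ ℚ.* r ℚ.* (q ℚ.* y) ℚ.+ (s ℚ.* t ℚ.* q ℚ.* r ℚ.+ r′ ℚ.* p ℚ.* t)
      ≤⟨ ℚ.+-monoˡ-≤ (s ℚ.* t ℚ.* q ℚ.* r ℚ.+ r′ ℚ.* p ℚ.* t) (*-monoˡ-≤ 0≤r′r qy≤px) ⟩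
    r′ ℚ.* r ℚ.* (p ℚ.* x) ℚ.+ (s ℚ.* t ℚ.* q ℚ.* r ℚ.+ r′ ℚ.* p ℚ.* t)
      ≡⟨ solve (q ∷ r ∷ r′ ∷ x ∷ s ∷ t ∷ p ∷ []) ℚ-ring ⟩
    r′ ℚ.* p ℚ.* (r ℚ.* x ℚ.+ t) ℚ.+ s ℚ.* t ℚ.* q ℚ.* r
      ≤⟨ ℚ.+-monoˡ-≤ (s ℚ.* t ℚ.* q ℚ.* r) (*-monoˡ-≤ 0≤r′p x-bound) ⟩
    r′ ℚ.* p ℚ.* (t ℚ.* r) ℚ.+ s ℚ.* t ℚ.* q ℚ.* r
      ≡⟨ solve (q ∷ r ∷ r′ ∷ s ∷ t ∷ p ∷ []) ℚ-ring ⟩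
    t ℚ.* (r′ ℚ.* p ℚ.* r ℚ.+ s ℚ.* q ℚ.* r)
      ≤⟨ *-monoˡ-≤ 0≤t poly ⟩
    t ℚ.* (s ℚ.* q ℚ.* r ℚ.* r′ ℚ.+ r′ ℚ.* p)
      ≡⟨ solve (q ∷ r ∷ r′ ∷ s ∷ t ∷ p ∷ []) ℚ-ring ⟩
    q ℚ.* r ℚ.* (s ℚ.* t ℚ.* r′) ℚ.+ r′ ℚ.* p ℚ.* t ∎))
  where open ℚ.≤-Reasoning

-- Polynomial inequalities over ℕ, decided by normalisation

infixl 6 _⊞_
infixl 7 _⊠_

data Expr : Set where
  X       : Expr
  K       : ℕ → Expr
  _⊞_ _⊠_ : Expr → Expr → Expr

⟦_⟧ : Expr → ℕ → ℕ
⟦ X ⟧     x = x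
⟦ K c ⟧   x = c
⟦ e ⊞ f ⟧ x = ⟦ e ⟧ x + ⟦ f ⟧ x
⟦ e ⊠ f ⟧ x = ⟦ e ⟧ x * ⟦ f ⟧ x

infix 8 _[_]
_[_] : Expr → Expr → Expr
X       [ s ] = s
K c     [ s ] = K c
(e ⊞ f) [ s ] = e [ s ] ⊞ f [ s ]
(e ⊠ f) [ s ] = e [ s ] ⊠ f [ s ]

⟦[]⟧ : ∀ e s x → ⟦ e [ s ] ⟧ x ≡ ⟦ e ⟧ (⟦ s ⟧ x)
⟦[]⟧ X       s x = refl
⟦[]⟧ (K c)   s x = refl
⟦[]⟧ (e ⊞ f) s x = cong₂ _+_ (⟦[]⟧ e s x) (⟦[]⟧ f s x)
⟦[]⟧ (e ⊠ f) s x = cong₂ _*_ (⟦[]⟧ e s x) (⟦[]⟧ f s x)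

horner : List ℕ → ℕ → ℕ
horner []       x = 0
horner (c ∷ cs) x = c + x * horner cs x

infixl 6 _⊕_
infixl 7 _⊗_

_⊕_ : List ℕ → List ℕ → List ℕ
[]       ⊕ ds       = ds
(c ∷ cs) ⊕ []       = c ∷ cs
(c ∷ cs) ⊕ (d ∷ ds) = c + d ∷ cs ⊕ ds

scale : ℕ → List ℕ → List ℕ
scale c []       = []
scale c (d ∷ ds) = c * d ∷ scale c ds

_⊗_ : List ℕ → List ℕ → List ℕ
[]       ⊗ ds = []
(c ∷ cs) ⊗ ds = scale c ds ⊕ (0 ∷ cs ⊗ ds)

normal : Expr → List ℕ
normal X       = 0 ∷ 1 ∷ []
normal (K c)   = c ∷ []
normal (e ⊞ f) = normal e ⊕ normal f
normal (e ⊠ f) = normal e ⊗ normal f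

horner-⊕ : ∀ cs ds x → horner (cs ⊕ ds) x ≡ horner cs x + horner ds x
horner-⊕ []       ds       x = refl
horner-⊕ (c ∷ cs) []       x = sym (ℕ.+-identityʳ _)
horner-⊕ (c ∷ cs) (d ∷ ds) x = begin
  c + d + x * horner (cs ⊕ ds) x          ≡⟨ cong (λ t → c + d + x * t) (horner-⊕ cs ds x) ⟩
  c + d + x * (horner cs x + horner ds x) ≡⟨ shuffle c d x (horner cs x) (horner ds x) ⟩
  c + x * horner cs x + (d + x * horner ds x) ∎
  where
  open ≡-Reasoning
  shuffle : ∀ c d x u v → c + d + x * (u + v) ≡ c + x * u + (d + x * v)
  shuffle = solve-∀ ℕ-ring

horner-scale : ∀ c ds x → horner (scale c ds) x ≡ c * horner ds x
horner-scale c []       x = sym (ℕ.*-zeroʳ c)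
horner-scale c (d ∷ ds) x = begin
  c * d + x * horner (scale c ds) x ≡⟨ cong (λ t → c * d + x * t) (horner-scale c ds x) ⟩
  c * d + x * (c * horner ds x)     ≡⟨ shuffle c d x (horner ds x) ⟩
  c * (d + x * horner ds x)         ∎
  where
  open ≡-Reasoning
  shuffle : ∀ c d x u → c * d + x * (c * u) ≡ c * (d + x * u)
  shuffle = solve-∀ ℕ-ring

horner-⊗ : ∀ cs ds x → horner (cs ⊗ ds) x ≡ horner cs x * horner ds x
horner-⊗ []       ds x = refl
horner-⊗ (c ∷ cs) ds x = begin
  horner (scale c ds ⊕ (0 ∷ cs ⊗ ds)) x            ≡⟨ horner-⊕ (scale c ds) (0 ∷ cs ⊗ ds) x ⟩
  horner (scale c ds) x + x * horner (cs ⊗ ds) x   ≡⟨ cong₂ (λ u v → u + x * v) (horner-scale c ds x) (horner-⊗ cs ds x) ⟩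
  c * horner ds x + x * (horner cs x * horner ds x) ≡⟨ shuffle c x (horner cs x) (horner ds x) ⟩
  (c + x * horner cs x) * horner ds x               ∎
  where
  open ≡-Reasoning
  shuffle : ∀ c x u v → c * v + x * (u * v) ≡ (c + x * u) * v
  shuffle = solve-∀ ℕ-ring

horner-normal : ∀ e x → horner (normal e) x ≡ ⟦ e ⟧ x
horner-normal X       x = trans (cong (λ t → x * (1 + t)) (ℕ.*-zeroʳ x)) (ℕ.*-identityʳ x)
horner-normal (K c)   x = trans (cong (λ t → c + t) (ℕ.*-zeroʳ x)) (ℕ.+-identityʳ c)
horner-normal (e ⊞ f) x = trans (horner-⊕ (normal e) (normal f) x) (cong₂ _+_ (horner-normal e x) (horner-normal f x))
horner-normal (e ⊠ f) x = trans (horner-⊗ (normal e) (normal f) x) (cong₂ _*_ (horner-normal e x) (horner-normal f x))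

≤-by-slack : ∀ s e f slack → normal (e [ K s ⊞ X ]) ⊕ slack ≡ normal (f [ K s ⊞ X ]) →
             ∀ j → ⟦ e ⟧ (s + j) ≤ ⟦ f ⟧ (s + j)
≤-by-slack s e f slack eq j = subst₂ _≤_ (⟦[]⟧ e (K s ⊞ X) j) (⟦[]⟧ f (K s ⊞ X) j) (begin
  ⟦ e [ K s ⊞ X ] ⟧ j                                     ≡⟨ sym (horner-normal (e [ K s ⊞ X ]) j) ⟩
  horner (normal (e [ K s ⊞ X ])) j                       ≤⟨ ℕ.m≤m+n _ (horner slack j) ⟩
  horner (normal (e [ K s ⊞ X ])) j + horner slack j      ≡⟨ sym (horner-⊕ (normal (e [ K s ⊞ X ])) slack j) ⟩
  horner (normal (e [ K s ⊞ X ]) ⊕ slack) j               ≡⟨ cong (λ cs → horner cs j) eq ⟩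
  horner (normal (f [ K s ⊞ X ])) j                       ≡⟨ horner-normal (f [ K s ⊞ X ]) j ⟩
  ⟦ f [ K s ⊞ X ] ⟧ j                                     ∎)
  where open ℕ.≤-Reasoning

-- With n = k + 1, the defining recurrence of V reads γ k · V (k + 2) + β k · V k = α k · V (k + 1).
-- ν⁻ k / δ k = 16 + 16 / δ k and ν⁺ k / δ k = 16 + 32 / δ k are the lower and upper bounds for V (k + 1) / V k.
αᴱ βᴱ γᴱ δᴱ ν⁻ᴱ ν⁺ᴱ pronicᴱ : Expr
αᴱ      = K 8 ⊠ (K 1 ⊞ X) ⊠ (K 3 ⊠ (K 1 ⊞ X) ⊠ (K 1 ⊞ X) ⊞ K 5 ⊠ (K 1 ⊞ X) ⊞ K 1)
βᴱ      = K 128 ⊠ X ⊠ ((K 2 ⊞ X) ⊠ (K 2 ⊞ X))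
γᴱ      = (K 1 ⊞ X) ⊠ ((K 2 ⊞ X) ⊠ (K 2 ⊞ X))
δᴱ      = X ⊠ (K 1 ⊞ X) ⊠ (K 2 ⊞ X)
ν⁻ᴱ     = K 16 ⊞ K 16 ⊠ δᴱ
ν⁺ᴱ     = K 32 ⊞ K 16 ⊠ δᴱ
pronicᴱ = X ⊠ (K 1 ⊞ X)

α β γ δ ν⁻ ν⁺ pronic : ℕ → ℕ
α      = ⟦ αᴱ ⟧
β      = ⟦ βᴱ ⟧
γ      = ⟦ γᴱ ⟧
δ      = ⟦ δᴱ ⟧
ν⁻     = ⟦ ν⁻ᴱ ⟧
ν⁺     = ⟦ ν⁺ᴱ ⟧
pronic = ⟦ pronicᴱ ⟧

-- Each slack list is the coefficient list, in j = k − s, of the right side minus the left side.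
lower-ratio-poly : ∀ {k} → 2 ≤ k →
  δ (suc k) * β k * δ k + ν⁻ k * γ k * ν⁻ (suc k) ≤ δ (suc k) * α k * ν⁻ k
lower-ratio-poly (ℕ.s≤s (ℕ.s≤s {n = j} _)) = ≤-by-slack 2
  (δᴱ [ K 1 ⊞ X ] ⊠ βᴱ ⊠ δᴱ ⊞ ν⁻ᴱ ⊠ γᴱ ⊠ ν⁻ᴱ [ K 1 ⊞ X ]) (δᴱ [ K 1 ⊞ X ] ⊠ αᴱ ⊠ ν⁻ᴱ)
  (130560 ∷ 212864 ∷ 135168 ∷ 41984 ∷ 6400 ∷ 384 ∷ []) refl j

upper-ratio-poly : ∀ {k} → 4 ≤ k →
  δ (suc k) * ν⁺ k * α k ≤ δ (suc k) * β k * δ k + ν⁺ k * γ k * ν⁺ (suc k)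
upper-ratio-poly (ℕ.s≤s (ℕ.s≤s (ℕ.s≤s (ℕ.s≤s {n = j} _)))) = ≤-by-slack 4
  (δᴱ [ K 1 ⊞ X ] ⊠ ν⁺ᴱ ⊠ αᴱ) (δᴱ [ K 1 ⊞ X ] ⊠ βᴱ ⊠ δᴱ ⊞ ν⁺ᴱ ⊠ γᴱ ⊠ ν⁺ᴱ [ K 1 ⊞ X ])
  (222720 ∷ 696064 ∷ 559104 ∷ 201600 ∷ 37248 ∷ 3456 ∷ 128 ∷ []) refl j

log-concave-poly₁ : ∀ {k} → 2 ≤ k → α k * δ k ≤ γ k * ν⁻ k + γ k * ν⁻ k
log-concave-poly₁ (ℕ.s≤s (ℕ.s≤s {n = j} _)) = ≤-by-slack 2
  (αᴱ ⊠ δᴱ) (γᴱ ⊠ ν⁻ᴱ ⊞ γᴱ ⊠ ν⁻ᴱ)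
  (13632 ∷ 23600 ∷ 17176 ∷ 6680 ∷ 1456 ∷ 168 ∷ 8 ∷ []) refl j

log-concave-poly₂ : ∀ {k} → 2 ≤ k → α k * δ k * ν⁻ k ℕ.< γ k * ν⁻ k * ν⁻ k + β k * δ k * δ k
log-concave-poly₂ (ℕ.s≤s (ℕ.s≤s {n = j} _)) = ≤-by-slack 2
  (K 1 ⊞ αᴱ ⊠ δᴱ ⊠ ν⁻ᴱ) (γᴱ ⊠ ν⁻ᴱ ⊠ ν⁻ᴱ ⊞ βᴱ ⊠ δᴱ ⊠ δᴱ)
  (132095 ∷ 207616 ∷ 130176 ∷ 40576 ∷ 6272 ∷ 384 ∷ []) refl j

power-bound-poly : ∀ {k} → 4 ≤ k →
  pronic (suc k) * ν⁺ k * pronic k + 16 * δ k * pronic k ≤ 16 * δ k * pronic k * pronic (suc k) + pronic (suc k) * ν⁺ k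
power-bound-poly (ℕ.s≤s (ℕ.s≤s (ℕ.s≤s (ℕ.s≤s {n = j} _)))) = ≤-by-slack 4
  (pronicᴱ [ K 1 ⊞ X ] ⊠ ν⁺ᴱ ⊠ pronicᴱ ⊞ K 16 ⊠ δᴱ ⊠ pronicᴱ)
  (K 16 ⊠ δᴱ ⊠ pronicᴱ ⊠ pronicᴱ [ K 1 ⊞ X ] ⊞ pronicᴱ [ K 1 ⊞ X ] ⊠ ν⁺ᴱ)
  (960 ∷ 352 ∷ 32 ∷ []) refl j

V-recurrence : ∀ k → ℕ→ℚ (γ k) ℚ.* V (suc (suc k)) ℚ.+ ℕ→ℚ (β k) ℚ.* V k ≡ ℕ→ℚ (α k) ℚ.* V (suc k)
V-recurrence k = begin
  g ℚ.* ((a ℚ.- b) ℚ.* (+ 1 ℚ./ γ k)) ℚ.+ b ≡⟨ regroup g (+ 1 ℚ./ γ k) a b ⟩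
  (a ℚ.- b) ℚ.* (g ℚ.* (+ 1 ℚ./ γ k)) ℚ.+ b ≡⟨ cong (λ t → (a ℚ.- b) ℚ.* t ℚ.+ b) (ℕ→ℚ-*-reciprocal (γ k)) ⟩
  (a ℚ.- b) ℚ.* 1ℚ ℚ.+ b                    ≡⟨ cancel a b ⟩
  a                                         ∎
  where
  open ≡-Reasoning
  g a b : ℚ
  g = ℕ→ℚ (γ k)
  a = ℕ→ℚ (α k) ℚ.* V (suc k)
  b = ℕ→ℚ (β k) ℚ.* V k
  regroup : ∀ g r a b → g ℚ.* ((a ℚ.- b) ℚ.* r) ℚ.+ b ≡ (a ℚ.- b) ℚ.* (g ℚ.* r) ℚ.+ b
  regroup = solve-∀ ℚ-ring
  cancel : ∀ a b → (a ℚ.- b) ℚ.* 1ℚ ℚ.+ b ≡ a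
  cancel = solve-∀ ℚ-ring

RatioLowerBound RatioUpperBound PowerBound : ℕ → Set
RatioLowerBound k = ℕ→ℚ (ν⁻ k) ℚ.* V k ℚ.≤ ℕ→ℚ (δ k) ℚ.* V (suc k)
RatioUpperBound k = ℕ→ℚ (δ k) ℚ.* V (suc k) ℚ.≤ ℕ→ℚ (ν⁺ k) ℚ.* V k
-- V k ≤ 16^k (1 − 1 / pronic k)
PowerBound k = ℕ→ℚ (pronic k) ℚ.* V k ℚ.+ ℕ→ℚ 16 ^ℚ k ℚ.≤ ℕ→ℚ 16 ^ℚ k ℚ.* ℕ→ℚ (pronic k)

V-ratio-lower-step : ∀ j → let k = suc (suc j) in
  0ℚ ℚ.< V k × RatioLowerBound k → 0ℚ ℚ.< V (suc k) × RatioLowerBound (suc k)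
V-ratio-lower-step j (0<x , px≤qy) = 0<y ,
  ratio-lower-step (ℕ→ℚ (α k)) (ℕ→ℚ (β k)) (ℕ→ℚ (γ k))
    (ℕ→ℚ (ν⁻ k)) (ℕ→ℚ (δ k)) (ℕ→ℚ (ν⁻ (suc k))) (ℕ→ℚ (δ (suc k)))
    (ℚ.<⇒≤ 0<y) (*-nonNeg (ℕ→ℚ-nonNeg (δ (suc k))) (ℕ→ℚ-nonNeg (β k)))
    (*-pos (ℕ→ℚ-pos (ν⁻ k)) (ℕ→ℚ-pos (γ k)))
    (V-recurrence k) px≤qy poly
  where
  k : ℕ
  k = suc (suc j)
  0<y : 0ℚ ℚ.< V (suc k)
  0<y = 0<p*q⇒0<q (ℕ→ℚ-nonNeg (δ k)) (ℚ.<-≤-trans (*-pos (ℕ→ℚ-pos (ν⁻ k)) 0<x) px≤qy)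
  poly : ℕ→ℚ (δ (suc k)) ℚ.* ℕ→ℚ (β k) ℚ.* ℕ→ℚ (δ k)
           ℚ.+ ℕ→ℚ (ν⁻ k) ℚ.* ℕ→ℚ (γ k) ℚ.* ℕ→ℚ (ν⁻ (suc k))
         ℚ.≤ ℕ→ℚ (δ (suc k)) ℚ.* ℕ→ℚ (α k) ℚ.* ℕ→ℚ (ν⁻ k)
  poly = subst₂ ℚ._≤_
    (trans (ℕ→ℚ-+ (δ (suc k) * β k * δ k) (ν⁻ k * γ k * ν⁻ (suc k)))
           (cong₂ ℚ._+_ (ℕ→ℚ-*³ (δ (suc k)) (β k) (δ k)) (ℕ→ℚ-*³ (ν⁻ k) (γ k) (ν⁻ (suc k)))))
    (ℕ→ℚ-*³ (δ (suc k)) (α k) (ν⁻ k))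
    (ℕ→ℚ-mono-≤ (lower-ratio-poly {k} (ℕ.s≤s (ℕ.s≤s ℕ.z≤n))))

V-ratio-lower : ∀ j → 0ℚ ℚ.< V (suc (suc j)) × RatioLowerBound (suc (suc j))
V-ratio-lower zero    = toWitness {a? = 0ℚ ℚ.<? V 2} _ ,
                        toWitness {a? = ℕ→ℚ (ν⁻ 2) ℚ.* V 2 ℚ.≤? ℕ→ℚ (δ 2) ℚ.* V 3} _
V-ratio-lower (suc j) = V-ratio-lower-step j (V-ratio-lower j)

V-pos : ∀ k → 0ℚ ℚ.< V k
V-pos zero          = toWitness {a? = 0ℚ ℚ.<? V 0} _
V-pos (suc zero)    = toWitness {a? = 0ℚ ℚ.<? V 1} _
V-pos (suc (suc j)) = proj₁ (V-ratio-lower j)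

V-nonNeg : ∀ k → 0ℚ ℚ.≤ V k
V-nonNeg k = ℚ.<⇒≤ (V-pos k)

V-ratio-upper-step : ∀ j → let k = suc (suc (suc (suc j))) in RatioUpperBound k → RatioUpperBound (suc k)
V-ratio-upper-step j qy≤px =
  ratio-upper-step (ℕ→ℚ (α k)) (ℕ→ℚ (β k)) (ℕ→ℚ (γ k))
    (ℕ→ℚ (ν⁺ k)) (ℕ→ℚ (δ k)) (ℕ→ℚ (ν⁺ (suc k))) (ℕ→ℚ (δ (suc k)))
    (V-nonNeg (suc k)) (*-nonNeg (ℕ→ℚ-nonNeg (δ (suc k))) (ℕ→ℚ-nonNeg (β k)))
    (*-pos (ℕ→ℚ-pos (ν⁺ k)) (ℕ→ℚ-pos (γ k)))
    (V-recurrence k) qy≤px poly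
  where
  k : ℕ
  k = suc (suc (suc (suc j)))
  poly : ℕ→ℚ (δ (suc k)) ℚ.* ℕ→ℚ (ν⁺ k) ℚ.* ℕ→ℚ (α k)
         ℚ.≤ ℕ→ℚ (δ (suc k)) ℚ.* ℕ→ℚ (β k) ℚ.* ℕ→ℚ (δ k)
           ℚ.+ ℕ→ℚ (ν⁺ k) ℚ.* ℕ→ℚ (γ k) ℚ.* ℕ→ℚ (ν⁺ (suc k))
  poly = subst₂ ℚ._≤_
    (ℕ→ℚ-*³ (δ (suc k)) (ν⁺ k) (α k))
    (trans (ℕ→ℚ-+ (δ (suc k) * β k * δ k) (ν⁺ k * γ k * ν⁺ (suc k)))
           (cong₂ ℚ._+_ (ℕ→ℚ-*³ (δ (suc k)) (β k) (δ k)) (ℕ→ℚ-*³ (ν⁺ k) (γ k) (ν⁺ (suc k)))))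
    (ℕ→ℚ-mono-≤ (upper-ratio-poly {k} (ℕ.s≤s (ℕ.s≤s (ℕ.s≤s (ℕ.s≤s ℕ.z≤n))))))

V-ratio-upper : ∀ j → RatioUpperBound (suc (suc (suc (suc j))))
V-ratio-upper zero    = toWitness {a? = ℕ→ℚ (δ 4) ℚ.* V 5 ℚ.≤? ℕ→ℚ (ν⁺ 4) ℚ.* V 4} _
V-ratio-upper (suc j) = V-ratio-upper-step j (V-ratio-upper j)

V-power-bound-step : ∀ j → let k = suc (suc (suc (suc j))) in RatioUpperBound k → PowerBound k → PowerBound (suc k)
V-power-bound-step j qy≤px x-bound =
  power-bound-step (ℕ→ℚ (ν⁺ k)) (ℕ→ℚ (δ k)) (ℕ→ℚ (pronic k)) (ℕ→ℚ (pronic (suc k)))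
    (ℕ→ℚ 16) (ℕ→ℚ 16 ^ℚ k)
    (^ℚ-nonNeg k (ℕ→ℚ-nonNeg 16)) (*-nonNeg (ℕ→ℚ-nonNeg (pronic (suc k))) (ℕ→ℚ-nonNeg (pronic k)))
    (*-nonNeg (ℕ→ℚ-nonNeg (pronic (suc k))) (ℕ→ℚ-nonNeg (ν⁺ k))) (*-pos (ℕ→ℚ-pos (δ k)) (ℕ→ℚ-pos (pronic k)))
    qy≤px x-bound poly
  where
  k : ℕ
  k = suc (suc (suc (suc j)))
  poly : ℕ→ℚ (pronic (suc k)) ℚ.* ℕ→ℚ (ν⁺ k) ℚ.* ℕ→ℚ (pronic k)
           ℚ.+ ℕ→ℚ 16 ℚ.* ℕ→ℚ (δ k) ℚ.* ℕ→ℚ (pronic k)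
         ℚ.≤ ℕ→ℚ 16 ℚ.* ℕ→ℚ (δ k) ℚ.* ℕ→ℚ (pronic k) ℚ.* ℕ→ℚ (pronic (suc k))
           ℚ.+ ℕ→ℚ (pronic (suc k)) ℚ.* ℕ→ℚ (ν⁺ k)
  poly = subst₂ ℚ._≤_
    (trans (ℕ→ℚ-+ (pronic (suc k) * ν⁺ k * pronic k) (16 * δ k * pronic k))
           (cong₂ ℚ._+_ (ℕ→ℚ-*³ (pronic (suc k)) (ν⁺ k) (pronic k)) (ℕ→ℚ-*³ 16 (δ k) (pronic k))))
    (trans (ℕ→ℚ-+ (16 * δ k * pronic k * pronic (suc k)) (pronic (suc k) * ν⁺ k))
           (cong₂ ℚ._+_
             (trans (ℕ→ℚ-* (16 * δ k * pronic k) (pronic (suc k)))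
                    (cong (ℚ._* ℕ→ℚ (pronic (suc k))) (ℕ→ℚ-*³ 16 (δ k) (pronic k))))
             (ℕ→ℚ-* (pronic (suc k)) (ν⁺ k))))
    (ℕ→ℚ-mono-≤ (power-bound-poly {k} (ℕ.s≤s (ℕ.s≤s (ℕ.s≤s (ℕ.s≤s ℕ.z≤n))))))

V-power-bound : ∀ j → PowerBound (suc (suc (suc (suc j))))
V-power-bound zero    =
  toWitness {a? = ℕ→ℚ (pronic 4) ℚ.* V 4 ℚ.+ ℕ→ℚ 16 ^ℚ 4 ℚ.≤? ℕ→ℚ 16 ^ℚ 4 ℚ.* ℕ→ℚ (pronic 4)} _
V-power-bound (suc j) = V-power-bound-step j (V-ratio-upper j) (V-power-bound j)

V≤16^ : ∀ k → V k ℚ.≤ ℕ→ℚ 16 ^ℚ k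
V≤16^ zero                        = toWitness {a? = V 0 ℚ.≤? ℕ→ℚ 16 ^ℚ 0} _
V≤16^ (suc zero)                  = toWitness {a? = V 1 ℚ.≤? ℕ→ℚ 16 ^ℚ 1} _
V≤16^ (suc (suc zero))            = toWitness {a? = V 2 ℚ.≤? ℕ→ℚ 16 ^ℚ 2} _
V≤16^ (suc (suc (suc zero)))      = toWitness {a? = V 3 ℚ.≤? ℕ→ℚ 16 ^ℚ 3} _
V≤16^ k@(suc (suc (suc (suc j)))) = *-cancelˡ-≤ (ℕ→ℚ-pos (pronic k)) (begin
  P ℚ.* V k           ≡⟨ ℚ.+-identityʳ (P ℚ.* V k) ⟨
  P ℚ.* V k ℚ.+ 0ℚ    ≤⟨ ℚ.+-monoʳ-≤ (P ℚ.* V k) (^ℚ-nonNeg k (ℕ→ℚ-nonNeg 16)) ⟩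
  P ℚ.* V k ℚ.+ 16ᵏ   ≤⟨ V-power-bound j ⟩
  16ᵏ ℚ.* P           ≡⟨ ℚ.*-comm 16ᵏ P ⟩
  P ℚ.* 16ᵏ           ∎)
  where
  open ℚ.≤-Reasoning
  P 16ᵏ : ℚ
  P = ℕ→ℚ (pronic k)
  16ᵏ = ℕ→ℚ 16 ^ℚ k

V-growth : ∀ k → ℕ→ℚ 16 ℚ.* V (suc k) ℚ.≤ V (suc (suc k))
V-growth zero    = toWitness {a? = ℕ→ℚ 16 ℚ.* V 1 ℚ.≤? V 2} _
V-growth (suc j) = *-cancelˡ-≤ (ℕ→ℚ-pos (δ k)) (begin
  ℕ→ℚ (δ k) ℚ.* (ℕ→ℚ 16 ℚ.* V k) ≡⟨ ℚ.*-assoc (ℕ→ℚ (δ k)) (ℕ→ℚ 16) (V k) ⟨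
  ℕ→ℚ (δ k) ℚ.* ℕ→ℚ 16 ℚ.* V k   ≡⟨ cong (ℚ._* V k) (ℚ.*-comm (ℕ→ℚ (δ k)) (ℕ→ℚ 16)) ⟩
  ℕ→ℚ 16 ℚ.* ℕ→ℚ (δ k) ℚ.* V k   ≡⟨ cong (ℚ._* V k) (ℕ→ℚ-* 16 (δ k)) ⟨
  ℕ→ℚ (16 * δ k) ℚ.* V k         ≤⟨ *-monoʳ-≤ (V-nonNeg k) (ℕ→ℚ-mono-≤ (ℕ.m≤n+m (16 * δ k) 16)) ⟩
  ℕ→ℚ (ν⁻ k) ℚ.* V k             ≤⟨ proj₂ (V-ratio-lower j) ⟩
  ℕ→ℚ (δ k) ℚ.* V (suc k)        ∎)
  where
  open ℚ.≤-Reasoning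
  k : ℕ
  k = suc (suc j)

V-log-concave : ∀ k → V (suc k) ℚ.* V (suc (suc (suc k))) ℚ.< V (suc (suc k)) ℚ.* V (suc (suc k))
V-log-concave zero    = toWitness {a? = V 1 ℚ.* V 3 ℚ.<? V 2 ℚ.* V 2} _
V-log-concave (suc j) =
  ratio-lower⇒log-concave (ℕ→ℚ (α k)) (ℕ→ℚ (β k)) (ℕ→ℚ (γ k)) (ℕ→ℚ (ν⁻ k)) (ℕ→ℚ (δ k))
    (V-pos k) (ℕ→ℚ-nonNeg (γ k)) (*-nonNeg (*-nonNeg (ℕ→ℚ-nonNeg (γ k)) (ℕ→ℚ-nonNeg (δ k))) (ℕ→ℚ-nonNeg (δ k)))
    (V-recurrence k) (proj₂ (V-ratio-lower j)) poly₁ poly₂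
  where
  k : ℕ
  k = suc (suc j)
  2≤k : 2 ≤ k
  2≤k = ℕ.s≤s (ℕ.s≤s ℕ.z≤n)
  poly₁ : ℕ→ℚ (α k) ℚ.* ℕ→ℚ (δ k)
          ℚ.≤ ℕ→ℚ (γ k) ℚ.* ℕ→ℚ (ν⁻ k) ℚ.+ ℕ→ℚ (γ k) ℚ.* ℕ→ℚ (ν⁻ k)
  poly₁ = subst₂ ℚ._≤_
    (ℕ→ℚ-* (α k) (δ k))
    (trans (ℕ→ℚ-+ (γ k * ν⁻ k) (γ k * ν⁻ k)) (cong₂ ℚ._+_ (ℕ→ℚ-* (γ k) (ν⁻ k)) (ℕ→ℚ-* (γ k) (ν⁻ k))))
    (ℕ→ℚ-mono-≤ (log-concave-poly₁ 2≤k))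
  poly₂ : ℕ→ℚ (α k) ℚ.* ℕ→ℚ (δ k) ℚ.* ℕ→ℚ (ν⁻ k)
          ℚ.< ℕ→ℚ (γ k) ℚ.* ℕ→ℚ (ν⁻ k) ℚ.* ℕ→ℚ (ν⁻ k)
            ℚ.+ ℕ→ℚ (β k) ℚ.* ℕ→ℚ (δ k) ℚ.* ℕ→ℚ (δ k)
  poly₂ = subst₂ ℚ._<_
    (ℕ→ℚ-*³ (α k) (δ k) (ν⁻ k))
    (trans (ℕ→ℚ-+ (γ k * ν⁻ k * ν⁻ k) (β k * δ k * δ k))
           (cong₂ ℚ._+_ (ℕ→ℚ-*³ (γ k) (ν⁻ k) (ν⁻ k)) (ℕ→ℚ-*³ (β k) (δ k) (δ k))))
    (ℕ→ℚ-mono-< (log-concave-poly₂ 2≤k))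

V-root-increasing : ∀ m → V (suc m) ^ℚ suc (suc m) ℚ.≤ V (suc (suc m)) ^ℚ suc m
V-root-increasing m = ^ℚ-suc≤^ℚ (suc m) (V-nonNeg (suc m)) (ℕ→ℚ-nonNeg 16) (V-growth m) (V≤16^ (suc m))

theorem1p2 : (n : ℕ) → 2 ≤ n →
    (V (n ∸ 1) ^ℚ (n * (n + 1))) *ℚ (V (n + 1) ^ℚ ((n ∸ 1) * n))
      < V n ^ℚ (2 * (n ∸ 1) * (n + 1))
theorem1p2 (suc zero) (ℕ.s≤s ())
theorem1p2 n@(suc (suc m)) _ =
  log-concave⇒root-log-concave m (V-pos (suc m)) (V-nonNeg n) (V-nonNeg (n + 1))
    (subst (λ i → V (suc m) ℚ.* V i ℚ.< V n ℚ.* V n) (ℕ.+-comm 1 n) (V-log-concave m))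
    (V-root-increasing m)
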